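{- Every complete theory $U$ (i.e. for every sentence $B$ of its language, $U\vdash B$ or $U\vdash\neg B$) is Friedman-reflexive.
   Context: Theories are first-order theories in finite signature with arbitrary (not necessarily recursively enumerable) axiom sets, possibly inconsistent; interpretations may be multi-dimensional and piecewise; $V\rhd W$ means $V$ interprets $W$. A $U$-sentence $C$ is an interpreter of finitely axiomatised $A$ over $U$ iff for all $U$-sentences $B$: $(U+B)\rhd A$ iff $U+B\vdash C$; $U$ is Friedman-reflexive iff every finitely axiomatised $A$ has an interpreter over $U$. -}

module Defs where

open import Level using (Level; 0ℓ) renaming (suc to lsuc)
open import Data.Nat using (ℕ; zero; suc; _+_)
open import Data.Fin using (Fin; zero; suc; splitAt; _↑ˡ_; _↑ʳ_)
open import Data.Sum using (_⊎_; inj₁; inj₂; [_,_]′)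
open import Data.Product using (Σ; _×_; _,_)
open import Data.List using (List)
open import Data.List.Membership.Propositional using (_∈_)
open import Relation.Binary.PropositionalEquality using (_≡_)
open import Function.Bundles using (_⇔_)

-- Finite relational signatures (with identity built into the logic)

record Signature : Set where
  field
    nrel  : ℕ
    arity : Fin nrel → ℕ
open Signature public

-- Formulas with at most n free variables (de Bruijn), classical
-- primitive connectives ⊥, ⇒, ∀ ; others are defined.

data Formula (S : Signature) (n : ℕ) : Set where
  ⊥'   : Formula S n
  _≐_  : Fin n → Fin n → Formula S n
  rel  : (r : Fin (nrel S)) → (Fin (arity S r) → Fin n) → Formula S n
  _⇒_  : Formula S n → Formula S n → Formula S n
  ∀'   : Formula S (suc n) → Formula S n

infixr 5 _⇒_

Sentence : Signature → Set
Sentence S = Formula S 0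

module _ {S : Signature} where

  ¬' : ∀ {n} → Formula S n → Formula S n
  ¬' φ = φ ⇒ ⊥'

  ⊤' : ∀ {n} → Formula S n
  ⊤' = ⊥' ⇒ ⊥'

  _∧'_ : ∀ {n} → Formula S n → Formula S n → Formula S n
  φ ∧' ψ = ¬' (φ ⇒ ¬' ψ)

  ⋀ : ∀ {n} k → (Fin k → Formula S n) → Formula S n
  ⋀ zero    f = ⊤'
  ⋀ (suc k) f = f zero ∧' ⋀ k (λ i → f (suc i))

  -- ∀ over a block of m variables (the innermost m variables)
  ∀^ : ∀ {n} m → Formula S (m + n) → Formula S n
  ∀^ zero    φ = φ
  ∀^ (suc m) φ = ∀^ m (∀' φ)

  lift : ∀ {n m} → (Fin n → Fin m) → Fin (suc n) → Fin (suc m)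
  lift ρ zero    = zero
  lift ρ (suc i) = suc (ρ i)

  ren : ∀ {n m} → (Fin n → Fin m) → Formula S n → Formula S m
  ren ρ ⊥'         = ⊥'
  ren ρ (x ≐ y)    = ρ x ≐ ρ y
  ren ρ (rel r xs) = rel r (λ t → ρ (xs t))
  ren ρ (φ ⇒ ψ)    = ren ρ φ ⇒ ren ρ ψ
  ren ρ (∀' φ)     = ∀' (ren (lift ρ) φ)

  sub0 : ∀ {n} → Fin n → Fin (suc n) → Fin n
  sub0 x zero    = x
  sub0 x (suc i) = i

  _[_] : ∀ {n} → Formula S (suc n) → Fin n → Formula S n
  φ [ x ] = ren (sub0 x) φ

  -- sets of formulas (arbitrary, not necessarily r.e.)
  Hyps : ℕ → Set₁
  Hyps n = Formula S n → Set

  _,,_ : ∀ {n} → Hyps n → Formula S n → Hyps n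
  (Γ ,, φ) χ = Γ χ ⊎ χ ≡ φ

  wk : ∀ {n} → Hyps n → Hyps (suc n)
  wk Γ χ = Σ (Formula S _) λ ψ → Γ ψ × χ ≡ ren suc ψ

  infix 3 _⊢_
  data _⊢_ : ∀ {n} → Hyps n → Formula S n → Set₁ where
    hyp   : ∀ {n} {Γ : Hyps n} {φ} → Γ φ → Γ ⊢ φ
    ⇒I    : ∀ {n} {Γ : Hyps n} {φ ψ} → (Γ ,, φ) ⊢ ψ → Γ ⊢ φ ⇒ ψ
    ⇒E    : ∀ {n} {Γ : Hyps n} {φ ψ} → Γ ⊢ φ ⇒ ψ → Γ ⊢ φ → Γ ⊢ ψ
    raa   : ∀ {n} {Γ : Hyps n} {φ} → (Γ ,, ¬' φ) ⊢ ⊥' → Γ ⊢ φ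
    ∀I    : ∀ {n} {Γ : Hyps n} {φ} → wk Γ ⊢ φ → Γ ⊢ ∀' φ
    ∀E    : ∀ {n} {Γ : Hyps n} {φ} → Γ ⊢ ∀' φ → (x : Fin n) → Γ ⊢ φ [ x ]
    -- the domain is nonempty: a fresh variable may always be introduced
    nonempty : ∀ {n} {Γ : Hyps n} {φ} → wk Γ ⊢ ren suc φ → Γ ⊢ φ
    ≐refl : ∀ {n} {Γ : Hyps n} (x : Fin n) → Γ ⊢ x ≐ x
    ≐subst : ∀ {n} {Γ : Hyps n} {x y : Fin n} (φ : Formula S (suc n)) →
             Γ ⊢ x ≐ y → Γ ⊢ φ [ x ] → Γ ⊢ φ [ y ]

record Theory (S : Signature) : Set₁ where
  field
    Ax : Sentence S → Set
open Theory public

_⊢ₜ_ : ∀ {S} → Theory S → Sentence S → Set₁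
U ⊢ₜ φ = Ax U ⊢ φ

_+ₜ_ : ∀ {S} → Theory S → Sentence S → Theory S
Ax (U +ₜ B) χ = Ax U χ ⊎ χ ≡ B

fin : ∀ {S} → List (Sentence S) → Theory S
Ax (fin As) χ = χ ∈ As

-- Multi-dimensional piecewise translations (without parameters)

sumF : ∀ a → (Fin a → ℕ) → ℕ
sumF zero    d = 0
sumF (suc a) d = d zero + sumF a (λ t → d (suc t))

tuples : ∀ {N} a (d : Fin a → ℕ) → ((t : Fin a) → Fin (d t) → Fin N) →
         Fin (sumF a d) → Fin N
tuples zero    d f ()
tuples (suc a) d f i =
  [ f zero , tuples a (λ t → d (suc t)) (λ t → f (suc t)) ]′ (splitAt (d zero) i)

record Translation (V W : Signature) : Set where
  field
    k    : ℕ
    dim  : Fin k → ℕ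
    dom  : (j : Fin k) → Formula V (dim j)
    eqT  : (j j' : Fin k) → Formula V (dim j + dim j')
    relT : (r : Fin (nrel W)) (qs : Fin (arity W r) → Fin k) →
           Formula V (sumF (arity W r) (λ t → dim (qs t)))

module _ {V W : Signature} (τ : Translation V W) where
  open Translation τ

  -- ps assigns a piece to each free variable; env assigns to each free
  -- variable of W a tuple of V-variables of the appropriate dimension.
  tr : ∀ {n N} (ps : Fin n → Fin k) →
       ((i : Fin n) → Fin (dim (ps i)) → Fin N) →
       Formula W n → Formula V N
  tr ps env ⊥'         = ⊥'
  tr ps env (x ≐ y)    =
    ren (λ i → [ env x , env y ]′ (splitAt (dim (ps x)) i)) (eqT (ps x) (ps y))
  tr ps env (rel r xs) =
    ren (tuples (arity W r) (λ t → dim (ps (xs t))) (λ t → env (xs t)))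
        (relT r (λ t → ps (xs t)))
  tr ps env (φ ⇒ ψ)    = tr ps env φ ⇒ tr ps env ψ
  tr {N = N} ps env (∀' φ) = ⋀ k λ j →
    ∀^ (dim j) (ren (λ i → i ↑ˡ N) (dom j) ⇒
                tr (ext ps j) (env' j) φ)
    where
      ext : ∀ {n} → (Fin n → Fin k) → Fin k → Fin (suc n) → Fin k
      ext ps j zero    = j
      ext ps j (suc i) = ps i
      env' : (j : Fin k) → (i : Fin _) → Fin (dim (ext ps j i)) → Fin (dim j + N)
      env' j zero    v = v ↑ˡ N
      env' j (suc i) v = dim j ↑ʳ env i v

  trS : Sentence W → Sentence V
  trS = tr (λ ()) (λ ())

_▷_ : ∀ {S T} → Theory S → Theory T → Set₁
_▷_ {S} {T} V W =
  Σ (Translation S T) λ τ → (φ : Sentence T) → W ⊢ₜ φ → V ⊢ₜ trS τ φ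

IsInterpreter : ∀ {S T} → Theory S → Sentence S → List (Sentence T) → Set₁
IsInterpreter U C As = (B : Sentence _) → ((U +ₜ B) ▷ fin As) ⇔ ((U +ₜ B) ⊢ₜ C)

FriedmanReflexive : ∀ {S} → Theory S → Set₁
FriedmanReflexive {S} U =
  (T : Signature) (As : List (Sentence T)) →
  Σ (Sentence S) λ C → IsInterpreter U C As

Complete : ∀ {S} → Theory S → Set₁
Complete U = (B : Sentence _) → (U ⊢ₜ B) ⊎ (U ⊢ₜ ¬' B)

-- Completeness decides every B: either U ⊢ B, and then U + B interprets exactly
-- what U does, or U ⊢ ¬B, and then U + B is inconsistent and interprets everything.
-- So whether U + B interprets A depends on B only through the consistency of
-- U + B; the interpreter is ⊤ if U ▷ A and ⊥ otherwise (a case split by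
-- excluded middle, since U ▷ A need not be decidable).
module Submission where

open import Defs
open import Level using (0ℓ) renaming (suc to lsuc)
open import Axiom.ExcludedMiddle using (ExcludedMiddle)
open import Data.Sum using (inj₁; inj₂)
open import Data.List using (List)
open import Data.Product using (_,_)
open import Relation.Nullary using (¬_; yes; no; contradiction)
open import Relation.Unary using (_⊆′_)
open import Relation.Binary.PropositionalEquality using (refl)
open import Function.Bundles using (mk⇔)

module _ {S : Signature} where

  ,,-mono : ∀ {n} {Γ Δ : Hyps {S} n} {φ} → Γ ⊆′ Δ → (Γ ,, φ) ⊆′ (Δ ,, φ)
  ,,-mono Γ⊆Δ _ (inj₁ γ) = inj₁ (Γ⊆Δ _ γ)
  ,,-mono Γ⊆Δ _ (inj₂ e) = inj₂ e

  wk-mono : ∀ {n} {Γ Δ : Hyps {S} n} → Γ ⊆′ Δ → wk Γ ⊆′ wk Δ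
  wk-mono Γ⊆Δ _ (ψ , γ , e) = ψ , Γ⊆Δ ψ γ , e

  ⊢-weaken : ∀ {n} {Γ Δ : Hyps {S} n} {φ} → Γ ⊆′ Δ → Γ ⊢ φ → Δ ⊢ φ
  ⊢-weaken Γ⊆Δ (hyp γ) = hyp (Γ⊆Δ _ γ)
  ⊢-weaken Γ⊆Δ (⇒I d) = ⇒I (⊢-weaken (,,-mono Γ⊆Δ) d)
  ⊢-weaken Γ⊆Δ (⇒E d e) = ⇒E (⊢-weaken Γ⊆Δ d) (⊢-weaken Γ⊆Δ e)
  ⊢-weaken Γ⊆Δ (raa d) = raa (⊢-weaken (,,-mono Γ⊆Δ) d)
  ⊢-weaken Γ⊆Δ (∀I d) = ∀I (⊢-weaken (wk-mono Γ⊆Δ) d)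
  ⊢-weaken Γ⊆Δ (∀E d x) = ∀E (⊢-weaken Γ⊆Δ d) x
  ⊢-weaken Γ⊆Δ (nonempty d) = nonempty (⊢-weaken (wk-mono Γ⊆Δ) d)
  ⊢-weaken Γ⊆Δ (≐refl x) = ≐refl x
  ⊢-weaken Γ⊆Δ (≐subst φ d e) = ≐subst φ (⊢-weaken Γ⊆Δ d) (⊢-weaken Γ⊆Δ e)

  ⊢-explosion : ∀ {n} {Γ : Hyps {S} n} {φ} → Γ ⊢ ⊥' → Γ ⊢ φ
  ⊢-explosion d = raa (⊢-weaken (λ _ → inj₁) d)

  ⊢-cut : ∀ {n} {Γ : Hyps {S} n} {φ ψ} → Γ ⊢ φ → (Γ ,, φ) ⊢ ψ → Γ ⊢ ψ
  ⊢-cut d e = ⇒E (⇒I e) d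

module _ {S : Signature} {U : Theory S} where

  +ₜ-⊢-new : ∀ {B} → (U +ₜ B) ⊢ₜ B
  +ₜ-⊢-new = hyp (inj₂ refl)

  +ₜ-refuted : ∀ {B} → U ⊢ₜ ¬' B → (U +ₜ B) ⊢ₜ ⊥'
  +ₜ-refuted ⊢¬B = ⇒E (⊢-weaken (λ _ → inj₁) ⊢¬B) +ₜ-⊢-new

module _ {S T : Signature} {U : Theory S} {W : Theory T} where

  ▷-+ₜ : ∀ {B} → U ▷ W → (U +ₜ B) ▷ W
  ▷-+ₜ (τ , τ-sound) = τ , λ φ d → ⊢-weaken (λ _ → inj₁) (τ-sound φ d)

  ▷-cut : ∀ {B} → U ⊢ₜ B → (U +ₜ B) ▷ W → U ▷ W
  ▷-cut ⊢B (τ , τ-sound) = τ , λ φ d → ⊢-cut ⊢B (τ-sound φ d)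

  inconsistent-▷ : U ⊢ₜ ⊥' → U ▷ W
  inconsistent-▷ ⊢⊥ = record { k = 0 ; dim = λ () ; dom = λ () ; eqT = λ ()
                             ; relT = λ _ _ → ⊥' }
                    , λ _ _ → ⊢-explosion ⊢⊥

module _ {S T : Signature} {U : Theory S} {As : List (Sentence T)} where

  ⊤-interpreter : U ▷ fin As → IsInterpreter U ⊤' As
  ⊤-interpreter U▷A B = mk⇔ (λ _ → ⇒I +ₜ-⊢-new) (λ _ → ▷-+ₜ U▷A)

  ⊥-interpreter : Complete U → ¬ (U ▷ fin As) → IsInterpreter U ⊥' As
  ⊥-interpreter complete U⋫A B = mk⇔ to inconsistent-▷
    where
    to : (U +ₜ B) ▷ fin As → (U +ₜ B) ⊢ₜ ⊥'
    to U+B▷A with complete B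
    ... | inj₁ ⊢B  = contradiction (▷-cut ⊢B U+B▷A) U⋫A
    ... | inj₂ ⊢¬B = +ₜ-refuted ⊢¬B

theorem6p1 : ExcludedMiddle (lsuc 0ℓ) →
    (S : Signature) (U : Theory S) → Complete U → FriedmanReflexive U
theorem6p1 lem S U complete T As with lem {U ▷ fin As}
... | yes U▷A = ⊤' , ⊤-interpreter U▷A
... | no U⋫A  = ⊥' , ⊥-interpreter complete U⋫A
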